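{- Let $n=2k$ be even. No four-element subset of $\mathbb{Z}/n\mathbb{Z}$ is avoidable unless it consists solely of odd elements.
   Context: For a set $S$ with a binary operation, a subset $U\subseteq S$ is avoidable if there is a partition $\{A,B\}$ of $S$ such that no element of $U$ is the product (here: sum) of two distinct elements of $A$ or of two distinct elements of $B$. In $\mathbb{Z}/n\mathbb{Z}$, an element $b$ is even if there exists $x$ with $2x=b$, and odd otherwise. -}

module Defs where

open import Data.Nat using (ℕ; NonZero)
open import Data.Nat.DivMod using (_mod_)
import Data.Nat as ℕ
open import Data.Fin using (Fin; toℕ)
open import Data.Fin.Subset using (Subset; _∈_; _∉_)
open import Data.Bool using (Bool; true; false)
open import Data.Product using (∃; _×_)
open import Relation.Binary.PropositionalEquality using (_≡_; _≢_)
open import Relation.Nullary using (¬_)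

_⊕_ : ∀ {n} .{{_ : NonZero n}} → Fin n → Fin n → Fin n
_⊕_ {n} a b = (toℕ a ℕ.+ toℕ b) mod n

IsEven : ∀ {n} .{{_ : NonZero n}} → Fin n → Set
IsEven b = ∃ λ x → x ⊕ x ≡ b

IsOdd : ∀ {n} .{{_ : NonZero n}} → Fin n → Set
IsOdd b = ¬ IsEven b

-- a partition {A,B} of ℤ/nℤ is given by a colouring χ with A = χ⁻¹(true),
-- B = χ⁻¹(false), both blocks nonempty.
Avoidable : ∀ {n} .{{_ : NonZero n}} → Subset n → Set
Avoidable {n} U =
  ∃ λ (χ : Fin n → Bool) →
    (∃ λ a → χ a ≡ true) × (∃ λ b → χ b ≡ false) ×
    (∀ x y → x ≢ y → χ x ≡ χ y → (x ⊕ y) ∉ U)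

{-# OPTIONS --safe #-}

-- If p, q, r are distinct elements of U with p + q + r = 2h, then a = h - q,
-- b = h - r, c = h - p satisfy a + b = p, b + c = q, c + a = r; they are
-- distinct, and two of them share a block of any partition, so U is not
-- avoidable. When n is even, reduction mod n preserves parity, so if U has an
-- even element u, two of the three other elements have equal parity and the
-- triple they form with u has even sum.
module Submission where

open import Defs
open import Data.Nat using (ℕ; NonZero; _*_)
open import Data.Fin.Subset using (Subset; _∈_; ∣_∣)
open import Relation.Binary.PropositionalEquality using (_≡_)

open import Data.Bool using (false; true)
open import Data.Fin using (Fin; toℕ)
open import Data.Fin.Properties using (toℕ-fromℕ<; toℕ-injective; toℕ<n)
open import Data.Fin.Subset using (Nonempty; _∉_; _─_; _-_; ⁅_⁆; inside; outside)
open import Data.Fin.Subset.Properties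
  using (nonempty?; Empty-unique; ∣⊥∣≡0; p─⊥≡p; p─q⊆p; x∈⁅x⁆)
open import Data.Nat using (suc; _+_; _∸_; _%_; _/_; parity)
open import Data.Nat.DivMod
  using (_mod_; m%n<n; m≡m%n+[m/n]*n; %-distribˡ-+; [m+kn]%n≡m%n; m<n⇒m%n≡m)
open import Data.Nat.Properties
  using (+-comm; suc-injective; +-suc; +-cancelʳ-≡; m∸n+n≡m; <⇒≤)
open import Data.Nat.Tactic.RingSolver using (solve-∀)
open import Data.Parity.Base using (0ℙ; 1ℙ)
import Data.Parity.Base as ℙ
open import Data.Parity.Properties using (+-homo-+; *-homo-*; p+p≡0ℙ; *-zeroʳ; +-identityʳ)
open import Data.Product using (∃; ∃₂; _×_; _,_)
open import Data.Sum using (_⊎_; inj₁; inj₂)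
open import Data.Vec using (_∷_; here; there)
open import Function using (_∘_)
open import Relation.Binary.PropositionalEquality
  using (_≢_; refl; sym; trans; cong; cong₂; subst; ≢-sym; module ≡-Reasoning)
open import Relation.Nullary using (¬_; yes; no; contradiction)

open ≡-Reasoning

Bool-cases : ∀ b → b ≡ false ⊎ b ≡ true
Bool-cases false = inj₁ refl
Bool-cases true  = inj₂ refl

Parity-cases : ∀ p → p ≡ 0ℙ ⊎ p ≡ 1ℙ
Parity-cases 0ℙ = inj₁ refl
Parity-cases 1ℙ = inj₂ refl

∣p∣≢0⇒Nonempty : ∀ {n} {p : Subset n} → ∣ p ∣ ≢ 0 → Nonempty p
∣p∣≢0⇒Nonempty {n} {p} ∣p∣≢0 with nonempty? p
... | yes p≢∅ = p≢∅
... | no  p≡∅ = contradiction (trans (cong ∣_∣ (Empty-unique p≡∅)) (∣⊥∣≡0 n)) ∣p∣≢0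

x∈p⇒∣p∣≡1+∣p-x∣ : ∀ {n} {x : Fin n} (p : Subset n) → x ∈ p → ∣ p ∣ ≡ suc ∣ p - x ∣
x∈p⇒∣p∣≡1+∣p-x∣ (inside  ∷ p) here        = cong (suc ∘ ∣_∣) (sym (p─⊥≡p p))
x∈p⇒∣p∣≡1+∣p-x∣ (inside  ∷ p) (there x∈p) = cong suc (x∈p⇒∣p∣≡1+∣p-x∣ p x∈p)
x∈p⇒∣p∣≡1+∣p-x∣ (outside ∷ p) (there x∈p) = x∈p⇒∣p∣≡1+∣p-x∣ p x∈p

∣p∣≡1+m⇒∣p-x∣≡m : ∀ {n m} {x : Fin n} (p : Subset n) → ∣ p ∣ ≡ suc m → x ∈ p → ∣ p - x ∣ ≡ m
∣p∣≡1+m⇒∣p-x∣≡m p ∣p∣≡1+m x∈p = suc-injective (trans (sym (x∈p⇒∣p∣≡1+∣p-x∣ p x∈p)) ∣p∣≡1+m)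

x∈p─q⇒x∉q : ∀ {n} {x : Fin n} (p q : Subset n) → x ∈ p ─ q → x ∉ q
x∈p─q⇒x∉q (_ ∷ p) (outside ∷ q) here        ()
x∈p─q⇒x∉q (_ ∷ p) (_       ∷ q) (there x∈) (there x∈q) = x∈p─q⇒x∉q p q x∈ x∈q

x∈p-y⇒x∈p : ∀ {n} {x : Fin n} (p : Subset n) (y : Fin n) → x ∈ p - y → x ∈ p
x∈p-y⇒x∈p p y = p─q⊆p p ⁅ y ⁆

x∈p-y⇒x≢y : ∀ {n} {x : Fin n} (p : Subset n) (y : Fin n) → x ∈ p - y → x ≢ y
x∈p-y⇒x≢y p y x∈p-x refl = x∈p─q⇒x∉q p ⁅ y ⁆ x∈p-x (x∈⁅x⁆ y)

choose : ∀ {n m} (p : Subset n) → ∣ p ∣ ≡ suc m → ∃ λ x → x ∈ p × ∣ p - x ∣ ≡ m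
choose p ∣p∣≡1+m with ∣p∣≢0⇒Nonempty (subst (_≢ 0) (sym ∣p∣≡1+m) λ ())
... | x , x∈p = x , x∈p , ∣p∣≡1+m⇒∣p-x∣≡m p ∣p∣≡1+m x∈p

module _ {B : Set} {b₀ b₁ : B} (two : ∀ b → b ≡ b₀ ⊎ b ≡ b₁) where

  two-of-three : (x y z : B) → x ≡ y ⊎ y ≡ z ⊎ z ≡ x
  two-of-three x y z with two x | two y | two z
  ... | inj₁ refl | inj₁ refl | _         = inj₁ refl
  ... | inj₂ refl | inj₂ refl | _         = inj₁ refl
  ... | _         | inj₁ refl | inj₁ refl = inj₂ (inj₁ refl)
  ... | _         | inj₂ refl | inj₂ refl = inj₂ (inj₁ refl)
  ... | inj₁ refl | _         | inj₁ refl = inj₂ (inj₂ refl)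
  ... | inj₂ refl | _         | inj₂ refl = inj₂ (inj₂ refl)

  pigeonhole : ∀ {n} (f : Fin n → B) (p : Subset n) → ∣ p ∣ ≡ 3 →
               ∃₂ λ x y → x ∈ p × y ∈ p × x ≢ y × f x ≡ f y
  pigeonhole f p ∣p∣≡3
    with x , x∈p     , ∣p-x∣≡2   ← choose p ∣p∣≡3
    with y , y∈p-x   , ∣p-x-y∣≡1 ← choose (p - x) ∣p-x∣≡2
    with z , z∈p-x-y , _         ← choose (p - x - y) ∣p-x-y∣≡1
    = pick (two-of-three (f x) (f y) (f z))
    where
    y∈p : y ∈ p
    y∈p = x∈p-y⇒x∈p p x y∈p-x
    y≢x : y ≢ x
    y≢x = x∈p-y⇒x≢y p x y∈p-x
    z∈p-x : z ∈ p - x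
    z∈p-x = x∈p-y⇒x∈p (p - x) y z∈p-x-y
    z≢y : z ≢ y
    z≢y = x∈p-y⇒x≢y (p - x) y z∈p-x-y
    z∈p : z ∈ p
    z∈p = x∈p-y⇒x∈p p x z∈p-x
    z≢x : z ≢ x
    z≢x = x∈p-y⇒x≢y p x z∈p-x
    pick : f x ≡ f y ⊎ f y ≡ f z ⊎ f z ≡ f x → ∃₂ λ a b → a ∈ p × b ∈ p × a ≢ b × f a ≡ f b
    pick (inj₁ fx≡fy)        = x , y , x∈p , y∈p , ≢-sym y≢x , fx≡fy
    pick (inj₂ (inj₁ fy≡fz)) = y , z , y∈p , z∈p , ≢-sym z≢y , fy≡fz
    pick (inj₂ (inj₂ fz≡fx)) = z , x , z∈p , x∈p , z≢x , fz≡fx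

parity≡0ℙ⇒double : ∀ m → parity m ≡ 0ℙ → ∃ λ h → m ≡ h + h
parity≡0ℙ⇒double 0             _    = 0 , refl
parity≡0ℙ⇒double (suc (suc m)) even with parity≡0ℙ⇒double m even
... | h , refl = suc h , cong suc (sym (+-suc h h))

parity[m+m]≡0ℙ : ∀ m → parity (m + m) ≡ 0ℙ
parity[m+m]≡0ℙ m = trans (+-homo-+ m m) (p+p≡0ℙ (parity m))

parity[m+n+o]≡0ℙ : ∀ m n o → parity m ≡ 0ℙ → parity n ≡ parity o → parity (m + n + o) ≡ 0ℙ
parity[m+n+o]≡0ℙ m n o m-even n≡o = begin
  parity (m + n + o)                   ≡⟨ +-homo-+ (m + n) o ⟩
  parity (m + n) ℙ.+ parity o          ≡⟨ cong (ℙ._+ parity o) (+-homo-+ m n) ⟩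
  parity m ℙ.+ parity n ℙ.+ parity o   ≡⟨ cong₂ (λ π ρ → π ℙ.+ ρ ℙ.+ parity o) m-even n≡o ⟩
  parity o ℙ.+ parity o                ≡⟨ p+p≡0ℙ (parity o) ⟩
  0ℙ                                   ∎

parity[m%n]≡parity[m] : ∀ m n .{{_ : NonZero n}} → parity n ≡ 0ℙ → parity (m % n) ≡ parity m
parity[m%n]≡parity[m] m n n-even = sym (begin
  parity m                                ≡⟨ cong parity (m≡m%n+[m/n]*n m n) ⟩
  parity (m % n + m / n * n)              ≡⟨ +-homo-+ (m % n) (m / n * n) ⟩
  parity (m % n) ℙ.+ parity (m / n * n)   ≡⟨ cong (parity (m % n) ℙ.+_) multiple-even ⟩
  parity (m % n) ℙ.+ 0ℙ                   ≡⟨ +-identityʳ (parity (m % n)) ⟩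
  parity (m % n)                          ∎)
  where
  multiple-even : parity (m / n * n) ≡ 0ℙ
  multiple-even = trans (*-homo-* (m / n) n)
                        (trans (cong (parity (m / n) ℙ.*_) n-even) (*-zeroʳ (parity (m / n))))

[h+a]+[h+b]≡p+2N : ∀ {N} p q r h a b → p + q + r ≡ h + h → a + q ≡ N → b + r ≡ N →
                   (h + a) + (h + b) ≡ p + 2 * N
[h+a]+[h+b]≡p+2N {N} p q r h a b p+q+r≡h+h a+q≡N b+r≡N =
  +-cancelʳ-≡ (q + r) _ _ (begin
    (h + a) + (h + b) + (q + r)   ≡⟨ regroup h a b q r ⟩
    (h + h) + (a + q) + (b + r)   ≡⟨ cong₂ (λ s t → s + t + (b + r)) (sym p+q+r≡h+h) a+q≡N ⟩
    (p + q + r) + N + (b + r)     ≡⟨ cong ((p + q + r) + N +_) b+r≡N ⟩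
    (p + q + r) + N + N           ≡⟨ regroup′ p q r N ⟩
    p + 2 * N + (q + r)           ∎)
  where
  regroup : ∀ h a b q r → (h + a) + (h + b) + (q + r) ≡ (h + h) + (a + q) + (b + r)
  regroup = solve-∀
  regroup′ : ∀ p q r N → (p + q + r) + N + N ≡ p + 2 * N + (q + r)
  regroup′ = solve-∀

module _ {N : ℕ} .{{_ : NonZero N}} where

  toℕ-mod : ∀ m → toℕ (m mod N) ≡ m % N
  toℕ-mod m = toℕ-fromℕ< (m%n<n m N)

  ⊕-comm : (a b : Fin N) → a ⊕ b ≡ b ⊕ a
  ⊕-comm a b = cong (_mod N) (+-comm (toℕ a) (toℕ b))

  mod-⊕-mod : ∀ m n → (m mod N) ⊕ (n mod N) ≡ (m + n) mod N
  mod-⊕-mod m n = toℕ-injective (begin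
    toℕ ((m mod N) ⊕ (n mod N))             ≡⟨ toℕ-mod _ ⟩
    (toℕ (m mod N) + toℕ (n mod N)) % N     ≡⟨ cong₂ (λ s t → (s + t) % N) (toℕ-mod m) (toℕ-mod n) ⟩
    (m % N + n % N) % N                     ≡⟨ %-distribˡ-+ m n N ⟨
    (m + n) % N                             ≡⟨ toℕ-mod (m + n) ⟨
    toℕ ((m + n) mod N)                     ∎)

  [toℕ+kN]mod≡id : ∀ (a : Fin N) k → (toℕ a + k * N) mod N ≡ a
  [toℕ+kN]mod≡id a k = toℕ-injective (begin
    toℕ ((toℕ a + k * N) mod N)  ≡⟨ toℕ-mod _ ⟩
    (toℕ a + k * N) % N          ≡⟨ [m+kn]%n≡m%n (toℕ a) k N ⟩
    toℕ a % N                    ≡⟨ m<n⇒m%n≡m (toℕ<n a) ⟩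
    toℕ a                        ∎)

  IsEven⇒parity≡0ℙ : parity N ≡ 0ℙ → {u : Fin N} → IsEven u → parity (toℕ u) ≡ 0ℙ
  IsEven⇒parity≡0ℙ N-even (x , refl) = begin
    parity (toℕ (x ⊕ x))         ≡⟨ cong parity (toℕ-mod (toℕ x + toℕ x)) ⟩
    parity ((toℕ x + toℕ x) % N) ≡⟨ parity[m%n]≡parity[m] (toℕ x + toℕ x) N N-even ⟩
    parity (toℕ x + toℕ x)       ≡⟨ parity[m+m]≡0ℙ (toℕ x) ⟩
    0ℙ                           ∎

  -- h - x in ℤ/Nℤ; N is added first because ℕ subtraction truncates.
  corner : ℕ → Fin N → Fin N
  corner h x = (h + (N ∸ toℕ x)) mod N

  corner-⊕-corner : ∀ {h} {p q r : Fin N} → toℕ p + toℕ q + toℕ r ≡ h + h →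
                    corner h q ⊕ corner h r ≡ p
  corner-⊕-corner {h} {p} {q} {r} p+q+r≡h+h = begin
    corner h q ⊕ corner h r                           ≡⟨ mod-⊕-mod _ _ ⟩
    ((h + (N ∸ toℕ q)) + (h + (N ∸ toℕ r))) mod N     ≡⟨ cong (_mod N) sum≡p+2N ⟩
    (toℕ p + 2 * N) mod N                             ≡⟨ [toℕ+kN]mod≡id p 2 ⟩
    p                                                 ∎
    where
    complement : (x : Fin N) → N ∸ toℕ x + toℕ x ≡ N
    complement x = m∸n+n≡m (<⇒≤ (toℕ<n x))
    sum≡p+2N : (h + (N ∸ toℕ q)) + (h + (N ∸ toℕ r)) ≡ toℕ p + 2 * N
    sum≡p+2N = [h+a]+[h+b]≡p+2N (toℕ p) (toℕ q) (toℕ r) h _ _ p+q+r≡h+h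
                 (complement q) (complement r)

  triangle-unavoidable : ∀ {U : Subset N} {p q r} (a b c : Fin N) →
                         a ⊕ b ≡ p → b ⊕ c ≡ q → c ⊕ a ≡ r →
                         p ∈ U → q ∈ U → r ∈ U → p ≢ q → q ≢ r → r ≢ p → ¬ Avoidable U
  triangle-unavoidable a b c refl refl refl p∈U q∈U r∈U p≢q q≢r r≢p (χ , _ , _ , χ-avoids)
    with two-of-three Bool-cases (χ a) (χ b) (χ c)
  ... | inj₁ χa≡χb        = χ-avoids a b (λ { refl → q≢r (⊕-comm a c) }) χa≡χb p∈U
  ... | inj₂ (inj₁ χb≡χc) = χ-avoids b c (λ { refl → r≢p (⊕-comm b a) }) χb≡χc q∈U
  ... | inj₂ (inj₂ χc≡χa) = χ-avoids c a (λ { refl → p≢q (⊕-comm a b) }) χc≡χa r∈U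

  even-triple-unavoidable : ∀ {U : Subset N} {p q r} → p ∈ U → q ∈ U → r ∈ U →
                            p ≢ q → q ≢ r → r ≢ p →
                            parity (toℕ p + toℕ q + toℕ r) ≡ 0ℙ → ¬ Avoidable U
  even-triple-unavoidable {p = p} {q} {r} p∈U q∈U r∈U p≢q q≢r r≢p even
    with h , p+q+r≡h+h ← parity≡0ℙ⇒double _ even
    = triangle-unavoidable (corner h q) (corner h r) (corner h p)
        (corner-⊕-corner p+q+r≡h+h) (corner-⊕-corner q+r+p≡h+h) (corner-⊕-corner r+p+q≡h+h)
        p∈U q∈U r∈U p≢q q≢r r≢p
    where
    +-rotate : ∀ m n o → m + n + o ≡ o + m + n
    +-rotate = solve-∀
    q+r+p≡h+h : toℕ q + toℕ r + toℕ p ≡ h + h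
    q+r+p≡h+h = trans (+-rotate (toℕ q) (toℕ r) (toℕ p)) p+q+r≡h+h
    r+p+q≡h+h : toℕ r + toℕ p + toℕ q ≡ h + h
    r+p+q≡h+h = trans (+-rotate (toℕ r) (toℕ p) (toℕ q)) q+r+p≡h+h

  even-element-unavoidable : parity N ≡ 0ℙ → {U : Subset N} {u : Fin N} →
                             ∣ U ∣ ≡ 4 → u ∈ U → IsEven u → ¬ Avoidable U
  even-element-unavoidable N-even {U} {u} ∣U∣≡4 u∈U u-even =
    let q , r , q∈U-u , r∈U-u , q≢r , parity-q≡parity-r =
          pigeonhole Parity-cases (parity ∘ toℕ) (U - u) (∣p∣≡1+m⇒∣p-x∣≡m U ∣U∣≡4 u∈U)
    in even-triple-unavoidable u∈U (x∈p-y⇒x∈p U u q∈U-u) (x∈p-y⇒x∈p U u r∈U-u)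
         (≢-sym (x∈p-y⇒x≢y U u q∈U-u)) q≢r (x∈p-y⇒x≢y U u r∈U-u)
         (parity[m+n+o]≡0ℙ (toℕ u) (toℕ q) (toℕ r)
           (IsEven⇒parity≡0ℙ N-even u-even) parity-q≡parity-r)

lemma2p1 : (k : ℕ) .{{_ : NonZero (2 * k)}} → (U : Subset (2 * k)) →
    ∣ U ∣ ≡ 4 → Avoidable U → ∀ u → u ∈ U → IsOdd u
lemma2p1 k U ∣U∣≡4 U-avoidable u u∈U u-even =
  even-element-unavoidable (*-homo-* 2 k) ∣U∣≡4 u∈U u-even U-avoidable
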